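{- If $A$ is a c.e. set such that $A\sqcup B$ is a Friedberg splitting of a simple set for some c.e. set $B$, then $\mathcal{D}(A)$ is generated by $\{W\}$ for some noncomputable c.e. set $W$.
   Context: All sets are c.e. subsets of $\omega$. A c.e. set is simple if it is coinfinite and its complement contains no infinite c.e. set. A splitting $A_0\sqcup A_1=C$ (disjoint c.e. sets with union $C$) is Friedberg if for every c.e. $W$: if $W-C$ is not c.e., then neither $W-A_0$ nor $W-A_1$ is c.e. $X\subseteq^*Y$ means $X-Y$ is finite. A collection $\mathcal{G}$ of c.e. sets generates $\mathcal{D}(A)$ if every member of $\mathcal{G}$ is disjoint from $A$ and every c.e. set disjoint from $A$ is $\subseteq^*$ the union of finitely many members of $\mathcal{G}$. -}

module Defs where

open import Level using (0ℓ)
open import Data.Nat using (ℕ; zero; suc; _<_)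
open import Data.Fin using (Fin)
open import Data.Vec using (Vec; []; _∷_; lookup)
open import Data.Product using (Σ; ∃; _×_; _,_)
open import Data.Sum using (_⊎_)
open import Data.List using (List)
open import Data.List.Relation.Unary.Any using (Any)
open import Data.Empty using (⊥)
open import Relation.Nullary using (¬_)
open import Relation.Unary using (Pred; _⊆_; ∁)
open import Function.Bundles using (_⇔_)

-- Model of computation: codes of partial recursive (μ-recursive)
-- functions of arity n, with an inductive big-step evaluation relation.

data PR : ℕ → Set where
  pzero : ∀ {n} → PR n
  psucc : PR 1
  pproj : ∀ {n} → Fin n → PR n
  pcomp : ∀ {m n} → PR m → Vec (PR n) m → PR n
  prec  : ∀ {n} → PR n → PR (suc (suc n)) → PR (suc n)
  pmu   : ∀ {n} → PR (suc n) → PR n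

mutual
  data _⊢_⇓_ : ∀ {n} → PR n → Vec ℕ n → ℕ → Set where
    ev-zero : ∀ {n} {xs : Vec ℕ n} → pzero ⊢ xs ⇓ 0
    ev-succ : ∀ {x} → psucc ⊢ (x ∷ []) ⇓ suc x
    ev-proj : ∀ {n} {i : Fin n} {xs} → pproj i ⊢ xs ⇓ lookup xs i
    ev-comp : ∀ {m n} {f : PR m} {gs : Vec (PR n) m} {xs ys y} →
              gs ⊢* xs ⇓ ys → f ⊢ ys ⇓ y → pcomp f gs ⊢ xs ⇓ y
    ev-rec0 : ∀ {n} {f : PR n} {g} {xs y} →
              f ⊢ xs ⇓ y → prec f g ⊢ (0 ∷ xs) ⇓ y
    ev-recS : ∀ {n} {f : PR n} {g} {k xs r y} →
              prec f g ⊢ (k ∷ xs) ⇓ r → g ⊢ (k ∷ r ∷ xs) ⇓ y →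
              prec f g ⊢ (suc k ∷ xs) ⇓ y
    ev-mu   : ∀ {n} {f : PR (suc n)} {xs y} →
              f ⊢ (y ∷ xs) ⇓ 0 →
              (∀ z → z < y → ∃ λ w → f ⊢ (z ∷ xs) ⇓ suc w) →
              pmu f ⊢ xs ⇓ y

  data _⊢*_⇓_ : ∀ {m n} → Vec (PR n) m → Vec ℕ n → Vec ℕ m → Set where
    ev-[] : ∀ {n} {xs : Vec ℕ n} → [] ⊢* xs ⇓ []
    ev-∷  : ∀ {m n} {g : PR n} {gs : Vec (PR n) m} {xs y ys} →
            g ⊢ xs ⇓ y → gs ⊢* xs ⇓ ys → (g ∷ gs) ⊢* xs ⇓ (y ∷ ys)

Set-ℕ : Set₁
Set-ℕ = Pred ℕ 0ℓ

CE : Set-ℕ → Set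
CE S = Σ (PR 1) λ f → ∀ x → S x ⇔ (∃ λ y → f ⊢ (x ∷ []) ⇓ y)

Computable : Set-ℕ → Set
Computable S = Σ (PR 1) λ f → ∀ x →
  (S x × f ⊢ (x ∷ []) ⇓ 1) ⊎ (¬ S x × f ⊢ (x ∷ []) ⇓ 0)

Finite : Set-ℕ → Set
Finite S = ∃ λ n → ∀ x → S x → x < n

Infinite : Set-ℕ → Set
Infinite S = ¬ Finite S

_∖_ : Set-ℕ → Set-ℕ → Set-ℕ
(X ∖ Y) x = X x × ¬ Y x

_⊆*_ : Set-ℕ → Set-ℕ → Set
X ⊆* Y = Finite (X ∖ Y)

Disjoint : Set-ℕ → Set-ℕ → Set
Disjoint X Y = ∀ x → X x → Y x → ⊥

Simple : Set-ℕ → Set₁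
Simple C = CE C × Infinite (∁ C) ×
  (∀ (W : Set-ℕ) → CE W → Infinite W → ¬ (W ⊆ ∁ C))

Splitting : Set-ℕ → Set-ℕ → Set-ℕ → Set
Splitting A₀ A₁ C = CE A₀ × CE A₁ × Disjoint A₀ A₁ ×
  (∀ x → C x ⇔ (A₀ x ⊎ A₁ x))

FriedbergSplitting : Set-ℕ → Set-ℕ → Set-ℕ → Set₁
FriedbergSplitting A₀ A₁ C = Splitting A₀ A₁ C ×
  (∀ (W : Set-ℕ) → CE W → ¬ CE (W ∖ C) → ¬ CE (W ∖ A₀) × ¬ CE (W ∖ A₁))

⋃[_]_ : ∀ {I : Set} → (I → Set-ℕ) → List I → Set-ℕ
(⋃[ G ] is) x = Any (λ i → G i x) is

Generates-D : ∀ {I : Set} → (I → Set-ℕ) → Set-ℕ → Set₁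
Generates-D {I} G A = (∀ i → CE (G i)) × (∀ i → Disjoint (G i) A) ×
  (∀ (X : Set-ℕ) → CE X → Disjoint X A →
     ∃ λ (is : List I) → X ⊆* (⋃[ G ] is))

module Submission where

-- Let A ⊔ B = C be a Friedberg splitting of a simple set C.  We show that
-- the single set B generates 𝒟(A) and is noncomputable.
--
--  * Generation.  If X is c.e. and disjoint from A, then X - A = X is c.e.;
--    by the Friedberg property X - C is then c.e. as well (classically, by
--    contraposition).  X - C is a c.e. subset of the complement of the
--    simple set C, hence finite.  Since X - B ⊆ X - C, we get X ⊆* B.
--  * Noncomputability.  The complement ω - C of a simple set is not c.e.,
--    so by the Friedberg property ω - B is not c.e. either; but the
--    complement of a computable set is c.e.

open import Defs
open import Level using (0ℓ)
open import Data.Unit using (⊤; tt)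
open import Data.Product using (Σ; _×_; _,_; proj₁; proj₂; ∃)
open import Relation.Nullary using (¬_)
open import Relation.Unary using (_⊆_; ∁)
open import Axiom.ExcludedMiddle using (ExcludedMiddle)
open import Axiom.DoubleNegationElimination
  using (DoubleNegationElimination; em⇒dne)
open import Data.Nat.Properties using (<-cmp)
open import Data.Fin using () renaming (zero to fzero; suc to fsuc)
open import Data.Vec using (Vec; []; _∷_)
open import Data.Sum using (inj₁; inj₂)
open import Data.Empty using (⊥-elim)
open import Data.List using (List; []; _∷_)
open import Data.List.Relation.Unary.Any using (here)
open import Relation.Binary.PropositionalEquality using (_≡_; refl)
open import Relation.Binary using (tri<; tri≈; tri>)
open import Function.Bundles using (_⇔_; mk⇔; Equivalence)
import Function.Properties.Equivalence as ⇔

ω : Set-ℕ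
ω _ = ⊤

-- Evaluation is deterministic: a code has at most one output on each input.
-- For minimisation, two different least zeros would contradict each other.
mutual
  ⇓-deterministic : ∀ {n} {f : PR n} {xs y y′} →
                    f ⊢ xs ⇓ y → f ⊢ xs ⇓ y′ → y ≡ y′
  ⇓-deterministic ev-zero ev-zero = refl
  ⇓-deterministic ev-succ ev-succ = refl
  ⇓-deterministic ev-proj ev-proj = refl
  ⇓-deterministic (ev-comp gs f) (ev-comp gs′ f′)
    with ⇓*-deterministic gs gs′
  ... | refl = ⇓-deterministic f f′
  ⇓-deterministic (ev-rec0 f) (ev-rec0 f′) = ⇓-deterministic f f′
  ⇓-deterministic (ev-recS r g) (ev-recS r′ g′) with ⇓-deterministic r r′
  ... | refl = ⇓-deterministic g g′
  ⇓-deterministic (ev-mu {y = y} zero-at-y below-y)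
                  (ev-mu {y = y′} zero-at-y′ below-y′) with <-cmp y y′
  ... | tri< y<y′ _ _
    with ⇓-deterministic zero-at-y (proj₂ (below-y′ y y<y′))
  ...   | ()
  ⇓-deterministic (ev-mu _ _) (ev-mu _ _) | tri≈ _ y≡y′ _ = y≡y′
  ⇓-deterministic (ev-mu zero-at-y below-y) (ev-mu {y = y′} zero-at-y′ _)
    | tri> _ _ y′<y
    with ⇓-deterministic zero-at-y′ (proj₂ (below-y y′ y′<y))
  ...   | ()

  ⇓*-deterministic : ∀ {m n} {gs : Vec (PR n) m} {xs ys ys′} →
                     gs ⊢* xs ⇓ ys → gs ⊢* xs ⇓ ys′ → ys ≡ ys′
  ⇓*-deterministic ev-[] ev-[] = refl
  ⇓*-deterministic (ev-∷ g gs) (ev-∷ g′ gs′)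
    with ⇓-deterministic g g′ | ⇓*-deterministic gs gs′
  ... | refl | refl = refl

CE-resp-⇔ : ∀ {X Y : Set-ℕ} → (∀ x → X x ⇔ Y x) → CE X → CE Y
CE-resp-⇔ X⇔Y (f , dom) = f , λ x → ⇔.trans (⇔.sym (X⇔Y x)) (dom x)

CE-ω : CE ω
CE-ω = pzero , λ _ → mk⇔ (λ _ → 0 , ev-zero) (λ _ → tt)

-- The complement of a computable set S is c.e.: it is the domain of
-- μy. χ_S(x), which halts (with 0) exactly when χ_S(x) = 0.
computable⇒complement-CE : ∀ {S : Set-ℕ} → Computable S → CE (ω ∖ S)
computable⇒complement-CE {S} (χ , decides) = pmu χ-of-x , λ x → mk⇔ (to x) (from x)
  where
  -- χ-of-x (y, x) = χ(x), ignoring the search variable y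
  χ-of-x : PR 2
  χ-of-x = pcomp χ (pproj (fsuc fzero) ∷ [])

  to : ∀ x → (ω ∖ S) x → ∃ λ y → pmu χ-of-x ⊢ (x ∷ []) ⇓ y
  to x (_ , x∉S) with decides x
  ... | inj₁ (x∈S , _) = ⊥-elim (x∉S x∈S)
  ... | inj₂ (_ , χx≡0) = 0 , ev-mu (ev-comp (ev-∷ ev-proj ev-[]) χx≡0) (λ _ ())

  from : ∀ x → (∃ λ y → pmu χ-of-x ⊢ (x ∷ []) ⇓ y) → (ω ∖ S) x
  from x (_ , ev-mu (ev-comp (ev-∷ ev-proj ev-[]) χx≡0) _) with decides x
  ... | inj₂ (x∉S , _) = tt , x∉S
  ... | inj₁ (_ , χx≡1) with ⇓-deterministic χx≡1 χx≡0
  ...   | ()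

disjoint⇒difference-CE : ∀ {X A : Set-ℕ} → Disjoint X A → CE X → CE (X ∖ A)
disjoint⇒difference-CE {X} {A} X∩A=∅ = CE-resp-⇔ X⇔X∖A
  where
  X⇔X∖A : ∀ x → X x ⇔ (X ∖ A) x
  X⇔X∖A x = mk⇔ (λ x∈X → x∈X , X∩A=∅ x x∈X) proj₁

finite-⊆ : ∀ {X Y : Set-ℕ} → X ⊆ Y → Finite Y → Finite X
finite-⊆ X⊆Y (n , Y<n) = n , λ x x∈X → Y<n x (X⊆Y x∈X)

-- The complement of a simple set is not c.e.: it is infinite and lies in
-- the complement of C.
simple⇒complement-not-CE : ∀ {C : Set-ℕ} → Simple C → ¬ CE (ω ∖ C)
simple⇒complement-not-CE {C} (_ , ∁C-infinite , no-infinite-CE) ω∖C-CE =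
  no-infinite-CE (ω ∖ C) ω∖C-CE ω∖C-infinite proj₂
  where
  ω∖C-infinite : Infinite (ω ∖ C)
  ω∖C-infinite ω∖C-finite = ∁C-infinite (finite-⊆ (λ x∉C → tt , x∉C) ω∖C-finite)

simple⇒CE-in-complement-finite : DoubleNegationElimination 0ℓ →
  ∀ {C W : Set-ℕ} → Simple C → CE W → W ⊆ ∁ C → Finite W
simple⇒CE-in-complement-finite dne (_ , _ , no-infinite-CE) W-CE W⊆∁C =
  dne λ W-infinite → no-infinite-CE _ W-CE W-infinite W⊆∁C

-- The Friedberg property, read contrapositively (classically): if W - A₀ is
-- c.e. then so is W - C.
friedberg-reflects-CE : DoubleNegationElimination 0ℓ →
  ∀ {A₀ A₁ C W : Set-ℕ} → FriedbergSplitting A₀ A₁ C →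
  CE W → CE (W ∖ A₀) → CE (W ∖ C)
friedberg-reflects-CE dne (_ , friedberg) W-CE W∖A₀-CE =
  dne λ W∖C-not-CE → proj₁ (friedberg _ W-CE W∖C-not-CE) W∖A₀-CE

-- Each half of a Friedberg splitting of a set whose complement is not c.e.
-- is noncomputable, because the complement of a computable set is c.e.
friedberg-half-noncomputable : ∀ {A₀ A₁ C : Set-ℕ} → ¬ CE (ω ∖ C) →
  FriedbergSplitting A₀ A₁ C → ¬ Computable A₁
friedberg-half-noncomputable ω∖C-not-CE (_ , friedberg) A₁-computable =
  proj₂ (friedberg ω CE-ω ω∖C-not-CE) (computable⇒complement-CE A₁-computable)

friedberg-simple⇒disjoint-⊆*-other-half : DoubleNegationElimination 0ℓ →
  ∀ {A B C X : Set-ℕ} → Simple C → FriedbergSplitting A B C →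
  CE X → Disjoint X A → X ⊆* B
friedberg-simple⇒disjoint-⊆*-other-half dne {A} {B} {C} {X}
  C-simple split@((_ , _ , _ , C⇔A⊎B) , _) X-CE X∩A=∅ =
  finite-⊆ X∖B⊆X∖C X∖C-finite
  where
  X∖C-finite : Finite (X ∖ C)
  X∖C-finite = simple⇒CE-in-complement-finite dne C-simple
    (friedberg-reflects-CE dne split X-CE (disjoint⇒difference-CE X∩A=∅ X-CE))
    proj₂

  -- a point of X outside B is outside C, since it is not in A either
  X∖B⊆X∖C : (X ∖ B) ⊆ (X ∖ C)
  X∖B⊆X∖C {x} (x∈X , x∉B) = x∈X , x∉C
    where
    x∉C : ¬ C x
    x∉C x∈C with Equivalence.to (C⇔A⊎B x) x∈C
    ... | inj₁ x∈A = X∩A=∅ x x∈X x∈A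
    ... | inj₂ x∈B = x∉B x∈B

⊆*-singleton-union : ∀ {X W : Set-ℕ} → X ⊆* W →
  X ⊆* (⋃[ (λ (_ : ⊤) → W) ] (tt ∷ []))
⊆*-singleton-union = finite-⊆ λ (x∈X , x∉⋃) → x∈X , λ x∈W → x∉⋃ (here x∈W)

corollary3p16 : ExcludedMiddle 0ℓ →
    (A : Set-ℕ) → CE A →
    Σ Set-ℕ (λ B → Σ Set-ℕ (λ C → CE B × Simple C × FriedbergSplitting A B C)) →
    Σ Set-ℕ (λ W → CE W × ¬ Computable W × Generates-D (λ (_ : ⊤) → W) A)
corollary3p16 em A _ (B , C , B-CE , C-simple , split@((_ , _ , A∩B=∅ , _) , _)) =
  B , B-CE , B-noncomputable , (λ _ → B-CE) , B∩A=∅ , every-disjoint-CE-⊆*B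
  where
  B-noncomputable : ¬ Computable B
  B-noncomputable =
    friedberg-half-noncomputable (simple⇒complement-not-CE C-simple) split

  B∩A=∅ : ⊤ → Disjoint B A
  B∩A=∅ _ x x∈B x∈A = A∩B=∅ x x∈A x∈B

  every-disjoint-CE-⊆*B : ∀ X → CE X → Disjoint X A →
    ∃ λ (is : List ⊤) → X ⊆* (⋃[ (λ (_ : ⊤) → B) ] is)
  every-disjoint-CE-⊆*B X X-CE X∩A=∅ = tt ∷ [] , ⊆*-singleton-union
    (friedberg-simple⇒disjoint-⊆*-other-half (em⇒dne em) C-simple split X-CE X∩A=∅)
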